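{- Let $D$ be a finite digraph. Then the coresets of $D$ (together with $\emptyset$) partition $V(D)$, where parts of a partition are allowed to be empty; that is, distinct coresets are pairwise disjoint and every vertex of $D$ lies in some coreset. Moreover, the successor sets $\alpha(U)$ of the coresets $U$, together with the set $\alpha(\emptyset)$ of sources of $D$, also partition $V(D)$: for distinct coresets $U\neq W$ we have $\alpha(U)\cap\alpha(W)=\emptyset$, each $\alpha(U)$ is disjoint from the set of sources, and the union of all these sets is $V(D)$.
   Context: Digraphs are finite; loops are allowed, multiple edges are not. A sink is a vertex with no successors; a source is a vertex with no predecessors. For a vertex $v$, $\alpha(v)$ is the set of successors of $v$ and $\beta(v)$ the set of predecessors. For a nonempty set $S\subseteq V(D)$, $\alpha(S)=\bigcup_{v\in S}\alpha(v)$ and $\beta(S)=\bigcup_{v\in S}\beta(v)$; by convention $\alpha(\emptyset)$ is the set of sources and $\beta(\emptyset)$ is the set of sinks. A coreset of $D$ is either (1) the set of all sinks of $D$ (the trivial coreset; it may be empty), or (2) a minimal nonempty set $U\subseteq V(D)$ such that $\beta(\alpha(U))=U$ (a nontrivial coreset). -}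

module Defs where

open import Data.Nat using (ℕ; zero; suc)
open import Data.Bool using (Bool; true; false; _∧_; _∨_; not; if_then_else_)
open import Data.Fin using (Fin; zero; suc)
open import Data.Vec using (lookup; tabulate)
open import Data.Fin.Subset using (Subset; _∈_; _⊆_; Nonempty)
open import Data.Product using (Σ; _×_)
open import Data.Sum using (_⊎_)
open import Relation.Binary.PropositionalEquality using (_≡_)

-- A finite digraph on vertex set Fin n (loops allowed, no multiple edges):
-- E u v ≡ true  iff  there is an arc u → v.
Digraph : ℕ → Set
Digraph n = Fin n → Fin n → Bool

anyF : ∀ {n} → (Fin n → Bool) → Bool
anyF {zero}  f = false
anyF {suc n} f = f zero ∨ anyF (λ i → f (suc i))

module _ {n : ℕ} (D : Digraph n) where

  sources : Subset n
  sources = tabulate λ w → not (anyF λ v → D v w)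

  sinks : Subset n
  sinks = tabulate λ v → not (anyF λ w → D v w)

  α : Subset n → Subset n
  α S = if anyF (lookup S)
          then tabulate (λ w → anyF λ v → lookup S v ∧ D v w)
          else sources

  β : Subset n → Subset n
  β S = if anyF (lookup S)
          then tabulate (λ v → anyF λ w → lookup S w ∧ D v w)
          else sinks

  Closed : Subset n → Set
  Closed U = Nonempty U × β (α U) ≡ U

  NontrivialCoreset : Subset n → Set
  NontrivialCoreset U = Closed U × (∀ V → Closed V → V ⊆ U → V ≡ U)

  IsCoreset : Subset n → Set
  IsCoreset U = (U ≡ sinks) ⊎ NontrivialCoreset U

module Submission where

-- Call a set U of vertices saturated if every vertex of U has a successor and U is closed
-- under "having a common successor". For nonempty U, β(α(U)) = U says exactly that U is
-- saturated, unless α(U) = ∅, in which case U is the set of sinks. Saturated sets are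
-- closed under intersection and relative complement, so the nontrivial coresets are the
-- minimal nonempty saturated sets: the classes of the equivalence relation generated by
-- "having a common successor" on the non-sinks, the class of v being the intersection of
-- all saturated sets containing v. Together with the sinks they partition V(D). Successor
-- sets of distinct classes are disjoint, since a common successor would merge the classes,
-- and no source is a successor of anything.

open import Defs
open import Data.Nat using (ℕ; zero; suc)
open import Data.Fin using (Fin; zero; suc)
open import Data.Fin.Subset using (Subset; _∈_; _∉_; _∩_; ∁; _⊆_; Empty; Nonempty)
open import Data.Fin.Subset.Properties
  using (_∈?_; nonempty?; anySubset?; ⊆-antisym; p∩q⊆p; p∩q⊆q; x∈p∩q⁺; x∈p∩q⁻; x∈∁p⇒x∉p; x∉p⇒x∈∁p)
open import Data.Fin.Properties using (all?; any?)
open import Data.Bool using (Bool; true; false; _∨_; _∧_; not)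
open import Data.Bool.Properties using (_≟_; ∨-zeroʳ; ¬-not; not-¬; not-injective)
open import Data.Vec using (lookup; tabulate)
open import Data.Vec.Properties using (lookup∘tabulate; []=⇒lookup; lookup⇒[]=)
open import Data.Product using (Σ; ∃; _×_; _,_; proj₁; proj₂)
import Data.Product as Product
open import Data.Sum using (_⊎_; inj₁; inj₂)
open import Data.Empty using (⊥-elim)
open import Function using (_∘_; flip; id)
open import Relation.Nullary using (¬_; Dec; yes; no; does; contradiction)
open import Relation.Nullary.Decidable using (_×-dec_; _→-dec_; ¬?; map′; dec-true)
open import Relation.Unary using (Pred; Decidable)
open import Relation.Binary.PropositionalEquality using (_≡_; _≢_; refl; sym; trans; cong; subst)

∧≡true⁻ : ∀ {a b} → a ∧ b ≡ true → a ≡ true × b ≡ true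
∧≡true⁻ {true} b≡true = refl , b≡true

anyF-true⁺ : ∀ {n} (f : Fin n → Bool) i → f i ≡ true → anyF f ≡ true
anyF-true⁺ f zero    fi = cong (_∨ anyF (f ∘ suc)) fi
anyF-true⁺ f (suc i) fi = trans (cong (f zero ∨_) (anyF-true⁺ (f ∘ suc) i fi)) (∨-zeroʳ (f zero))

anyF-true⁻ : ∀ {n} (f : Fin n → Bool) → anyF f ≡ true → ∃ λ i → f i ≡ true
anyF-true⁻ {zero}  f ()
anyF-true⁻ {suc n} f p with f zero in f0
... | true  = zero , f0
... | false = Product.map suc id (anyF-true⁻ (f ∘ suc) p)

anyF-false⁺ : ∀ {n} (f : Fin n → Bool) → (∀ i → f i ≢ true) → anyF f ≡ false
anyF-false⁺ f none = ¬-not {y = true} λ p → let (i , fi) = anyF-true⁻ f p in none i fi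

∈-tabulate⁺ : ∀ {n} {f : Fin n → Bool} {x} → f x ≡ true → x ∈ tabulate f
∈-tabulate⁺ {f = f} {x} fx = lookup⇒[]= x (tabulate f) (trans (lookup∘tabulate f x) fx)

∈-tabulate⁻ : ∀ {n} {f : Fin n → Bool} {x} → x ∈ tabulate f → f x ≡ true
∈-tabulate⁻ {f = f} {x} x∈ = trans (sym (lookup∘tabulate f x)) ([]=⇒lookup x∈)

nonempty⇒anyF : ∀ {n} {U : Subset n} → Nonempty U → anyF (lookup U) ≡ true
nonempty⇒anyF (u , u∈U) = anyF-true⁺ _ u ([]=⇒lookup u∈U)

empty⇒anyF : ∀ {n} {U : Subset n} → Empty U → anyF (lookup U) ≡ false
empty⇒anyF {U = U} empty = anyF-false⁺ (lookup U) λ u p → empty (u , lookup⇒[]= u U p)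

subset : ∀ {n ℓ} {P : Pred (Fin n) ℓ} → Decidable P → Subset n
subset P? = tabulate (does ∘ P?)

module _ {n ℓ} {P : Pred (Fin n) ℓ} (P? : Decidable P) {x : Fin n} where

  ∈-subset⁺ : P x → x ∈ subset P?
  ∈-subset⁺ p = ∈-tabulate⁺ (dec-true (P? x) p)

  ∈-subset⁻ : x ∈ subset P? → P x
  ∈-subset⁻ x∈ with P? x | ∈-tabulate⁻ {f = does ∘ P?} x∈
  ... | yes p | _ = p
  ... | no _  | ()

module Successors {n : ℕ} (D : Digraph n) where

  infix 4 _↦_
  _↦_ : Fin n → Fin n → Set
  u ↦ w = D u w ≡ true

  ∈sources⁺ : ∀ {x} → (∀ u → ¬ u ↦ x) → x ∈ sources D
  ∈sources⁺ none = ∈-tabulate⁺ (cong not (anyF-false⁺ _ none))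

  ∈sources⁻ : ∀ {u x} → x ∈ sources D → ¬ u ↦ x
  ∈sources⁻ {u} {x} x∈ u↦x = not-¬ (anyF-true⁺ (λ v → D v x) u u↦x) (not-injective (∈-tabulate⁻ x∈))

  α-empty : ∀ {U} → Empty U → α D U ≡ sources D
  α-empty empty rewrite empty⇒anyF empty = refl

  ∈α⁺ : ∀ {U u x} → u ∈ U → u ↦ x → x ∈ α D U
  ∈α⁺ {U} {u} {x} u∈U u↦x rewrite nonempty⇒anyF (u , u∈U) =
    ∈-tabulate⁺ (anyF-true⁺ _ u (trans (cong (_∧ D u x) ([]=⇒lookup u∈U)) u↦x))

  ∈α⁻ : ∀ {U x} → Nonempty U → x ∈ α D U → ∃ λ u → u ∈ U × u ↦ x
  ∈α⁻ {U} nonempty x∈ rewrite nonempty⇒anyF nonempty =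
    let (u , u∈U∧u↦x) = anyF-true⁻ _ (∈-tabulate⁻ x∈)
        (u∈U , u↦x)   = ∧≡true⁻ u∈U∧u↦x
    in u , lookup⇒[]= u U u∈U , u↦x

  ∈α⇒∉sources : ∀ {U x} → Nonempty U → x ∈ α D U → x ∉ sources D
  ∈α⇒∉sources nonempty x∈ x∈sources =
    let (_ , _ , u↦x) = ∈α⁻ nonempty x∈ in ∈sources⁻ x∈sources u↦x

  α∩sources-empty : ∀ {U} → Nonempty U → Empty (α D U ∩ sources D)
  α∩sources-empty {U} nonempty (_ , x∈αU∩sources) =
    let (x∈αU , x∈sources) = x∈p∩q⁻ (α D U) (sources D) x∈αU∩sources
    in ∈α⇒∉sources nonempty x∈αU x∈sources

module _ {n : ℕ} (D : Digraph n) where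

  open Successors D
  -- sinks D and β D are definitionally sources and α of the reversed digraph.
  open Successors (flip D) using ()
    renaming (∈sources⁺ to ∈sinks⁺; ∈sources⁻ to ∈sinks⁻; α-empty to β-empty; ∈α⁺ to ∈β⁺; ∈α⁻ to ∈β⁻)

  HasSuccessor : Fin n → Set
  HasSuccessor u = ∃ λ w → u ↦ w

  ShareSuccessor : Fin n → Fin n → Set
  ShareSuccessor u x = ∃ λ w → u ↦ w × x ↦ w

  hasSuccessor? : Decidable HasSuccessor
  hasSuccessor? u = any? λ w → D u w ≟ true

  shareSuccessor? : ∀ u x → Dec (ShareSuccessor u x)
  shareSuccessor? u x = any? λ w → (D u w ≟ true) ×-dec (D x w ≟ true)

  shareSuccessor-sym : ∀ {u x} → ShareSuccessor u x → ShareSuccessor x u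
  shareSuccessor-sym (w , u↦w , x↦w) = w , x↦w , u↦w

  ∉sinks⇒hasSuccessor : ∀ {u} → u ∉ sinks D → HasSuccessor u
  ∉sinks⇒hasSuccessor {u} u∉sinks with hasSuccessor? u
  ... | yes succ = succ
  ... | no none  = contradiction (∈sinks⁺ λ w u↦w → none (w , u↦w)) u∉sinks

  ShareClosed : Subset n → Set
  ShareClosed U = ∀ {u x} → u ∈ U → ShareSuccessor u x → x ∈ U

  record Saturated (U : Subset n) : Set where
    field
      hasSuccessor : ∀ {u} → u ∈ U → HasSuccessor u
      shareClosed  : ShareClosed U

  open Saturated

  saturated? : Decidable Saturated
  saturated? U = map′
    (λ (succ , closed) → record { hasSuccessor = λ {u} → succ u ; shareClosed = λ {u} {x} → closed u x })
    (λ S → (λ _ → hasSuccessor S) , λ _ _ → shareClosed S)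
    (all? (λ u → u ∈? U →-dec hasSuccessor? u)
      ×-dec all? λ u → all? λ x → u ∈? U →-dec (shareSuccessor? u x →-dec x ∈? U))

  saturated-∩ : ∀ {U V} → Saturated U → ShareClosed V → Saturated (U ∩ V)
  saturated-∩ {U} {V} S closedV = record
    { hasSuccessor = λ u∈U∩V → hasSuccessor S (proj₁ (x∈p∩q⁻ U V u∈U∩V))
    ; shareClosed  = λ u∈U∩V share → let (u∈U , u∈V) = x∈p∩q⁻ U V u∈U∩V in
                       x∈p∩q⁺ (shareClosed S u∈U share , closedV u∈V share)
    }

  shareClosed-∁ : ∀ {V} → ShareClosed V → ShareClosed (∁ V)
  shareClosed-∁ closedV u∈∁V share =
    x∉p⇒x∈∁p λ x∈V → x∈∁p⇒x∉p u∈∁V (closedV x∈V (shareSuccessor-sym share))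

  ∁sinks-saturated : Saturated (∁ (sinks D))
  ∁sinks-saturated = record
    { hasSuccessor = ∉sinks⇒hasSuccessor ∘ x∈∁p⇒x∉p
    ; shareClosed  = λ { _ (_ , _ , x↦w) → x∉p⇒x∈∁p λ x∈sinks → ∈sinks⁻ x∈sinks x↦w }
    }

  sink∉saturated : ∀ {U x} → Saturated U → x ∈ sinks D → x ∉ U
  sink∉saturated S x∈sinks x∈U = let (_ , x↦w) = hasSuccessor S x∈U in ∈sinks⁻ x∈sinks x↦w

  closed⇒sinks⊎saturated : ∀ {U} → Closed D U → U ≡ sinks D ⊎ Saturated U
  closed⇒sinks⊎saturated {U} (_ , βαU≡U) with nonempty? (α D U)
  ... | no  αU-empty    = inj₁ (trans (sym βαU≡U) (β-empty αU-empty))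
  ... | yes αU-nonempty = inj₂ record
    { hasSuccessor = λ u∈U → let (w , _ , u↦w) = ∈β⁻ αU-nonempty (subst (_ ∈_) (sym βαU≡U) u∈U) in w , u↦w
    ; shareClosed  = λ { u∈U (_ , u↦w , x↦w) → subst (_ ∈_) βαU≡U (∈β⁺ (∈α⁺ u∈U u↦w) x↦w) }
    }

  saturated⇒closed : ∀ {U} → Saturated U → Nonempty U → Closed D U
  saturated⇒closed {U} S nonempty@(_ , u₀∈U) = nonempty , ⊆-antisym βαU⊆U U⊆βαU
    where
    αU-nonempty : Nonempty (α D U)
    αU-nonempty = let (w , u₀↦w) = hasSuccessor S u₀∈U in w , ∈α⁺ u₀∈U u₀↦w

    U⊆βαU : U ⊆ β D (α D U)
    U⊆βαU u∈U = let (_ , u↦w) = hasSuccessor S u∈U in ∈β⁺ (∈α⁺ u∈U u↦w) u↦w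

    βαU⊆U : β D (α D U) ⊆ U
    βαU⊆U x∈ =
      let (_ , w∈αU , x↦w) = ∈β⁻ αU-nonempty x∈
          (_ , u∈U , u↦w)  = ∈α⁻ nonempty w∈αU
      in shareClosed S u∈U (_ , u↦w , x↦w)

  record MinSaturated (U : Subset n) : Set where
    field
      saturated : Saturated U
      nonempty  : Nonempty U
      minimal   : ∀ {V} → Saturated V → Nonempty V → V ⊆ U → V ≡ U

  open MinSaturated

  coreset⇒sinks⊎minSaturated : ∀ {U} → IsCoreset D U → U ≡ sinks D ⊎ MinSaturated U
  coreset⇒sinks⊎minSaturated (inj₁ U≡sinks) = inj₁ U≡sinks
  coreset⇒sinks⊎minSaturated (inj₂ (closed , minimalClosed)) with closed⇒sinks⊎saturated closed
  ... | inj₁ U≡sinks = inj₁ U≡sinks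
  ... | inj₂ S = inj₂ record
    { saturated = S
    ; nonempty  = proj₁ closed
    ; minimal   = λ SV nonemptyV → minimalClosed _ (saturated⇒closed SV nonemptyV)
    }

  minSaturated⇒coreset : ∀ {U} → MinSaturated U → IsCoreset D U
  minSaturated⇒coreset {U} M = inj₂ (saturated⇒closed (saturated M) (nonempty M) , minimalClosed)
    where
    minimalClosed : ∀ V → Closed D V → V ⊆ U → V ≡ U
    minimalClosed V closedV V⊆U with closed⇒sinks⊎saturated closedV
    ... | inj₂ SV      = minimal M SV (proj₁ closedV) V⊆U
    ... | inj₁ V≡sinks =
      let (y , y∈V) = proj₁ closedV
      in contradiction (V⊆U y∈V) (sink∉saturated (saturated M) (subst (y ∈_) V≡sinks y∈V))

  minSaturated-≡ : ∀ {U W x} → MinSaturated U → MinSaturated W → x ∈ U → x ∈ W → U ≡ W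
  minSaturated-≡ {U} {W} MU MW x∈U x∈W =
    trans (sym (minimal MU S∩ nonempty∩ (p∩q⊆p U W))) (minimal MW S∩ nonempty∩ (p∩q⊆q U W))
    where
    S∩ = saturated-∩ (saturated MU) (shareClosed (saturated MW))
    nonempty∩ = _ , x∈p∩q⁺ (x∈U , x∈W)

  Separable : Fin n → Fin n → Set
  Separable v x = ∃ λ U → Saturated U × v ∈ U × x ∉ U

  inseparable? : ∀ v → Decidable (¬_ ∘ Separable v)
  inseparable? v x = ¬? (anySubset? λ U → saturated? U ×-dec (v ∈? U ×-dec ¬? (x ∈? U)))

  saturation : Fin n → Subset n
  saturation v = subset (inseparable? v)

  module _ {v : Fin n} where

    ∈saturation⁺ : ∀ {x} → (∀ {U} → Saturated U → v ∈ U → x ∈ U) → x ∈ saturation v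
    ∈saturation⁺ inAll = ∈-subset⁺ (inseparable? v) λ (_ , S , v∈U , x∉U) → x∉U (inAll S v∈U)

    ∈saturation⁻ : ∀ {x U} → x ∈ saturation v → Saturated U → v ∈ U → x ∈ U
    ∈saturation⁻ {x} {U} x∈ S v∈U with x ∈? U
    ... | yes x∈U = x∈U
    ... | no  x∉U = contradiction (U , S , v∈U , x∉U) (∈-subset⁻ (inseparable? v) x∈)

    v∈saturation : v ∈ saturation v
    v∈saturation = ∈saturation⁺ λ _ v∈U → v∈U

    -- For a sink v no saturated set contains v, and saturation v is everything.
    saturation-saturated : HasSuccessor v → Saturated (saturation v)
    saturation-saturated (_ , v↦w) = record
      { hasSuccessor = λ x∈ → hasSuccessor ∁sinks-saturated (∈saturation⁻ x∈ ∁sinks-saturated v∈∁sinks)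
      ; shareClosed  = λ x∈ share → ∈saturation⁺ λ S v∈U → shareClosed S (∈saturation⁻ x∈ S v∈U) share
      }
      where
      v∈∁sinks : v ∈ ∁ (sinks D)
      v∈∁sinks = x∉p⇒x∈∁p λ v∈sinks → ∈sinks⁻ v∈sinks v↦w

    saturation-minSaturated : HasSuccessor v → MinSaturated (saturation v)
    saturation-minSaturated succ = record
      { saturated = saturation-saturated succ
      ; nonempty  = v , v∈saturation
      ; minimal   = minimalSaturation
      }
      where
      minimalSaturation : ∀ {V} → Saturated V → Nonempty V → V ⊆ saturation v → V ≡ saturation v
      minimalSaturation {V} SV (y , y∈V) V⊆ with v ∈? V
      ... | yes v∈V = ⊆-antisym V⊆ λ x∈ → ∈saturation⁻ x∈ SV v∈V
      ... | no  v∉V = contradiction y∈V (x∈∁p⇒x∉p (proj₂ (x∈p∩q⁻ _ _ y∈rest)))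
        where
        y∈rest : y ∈ saturation v ∩ ∁ V
        y∈rest = ∈saturation⁻ (V⊆ y∈V)
          (saturated-∩ (saturation-saturated succ) (shareClosed-∁ (shareClosed SV)))
          (x∈p∩q⁺ (v∈saturation , x∉p⇒x∈∁p v∉V))

    saturation-coreset : HasSuccessor v → IsCoreset D (saturation v)
    saturation-coreset = minSaturated⇒coreset ∘ saturation-minSaturated

  coresets-disjoint : ∀ U W → IsCoreset D U → IsCoreset D W → U ≢ W → Empty (U ∩ W)
  coresets-disjoint U W cU cW U≢W (x , x∈U∩W)
    with x∈p∩q⁻ U W x∈U∩W | coreset⇒sinks⊎minSaturated cU | coreset⇒sinks⊎minSaturated cW
  ... | _ | inj₁ U≡sinks | inj₁ W≡sinks = U≢W (trans U≡sinks (sym W≡sinks))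
  ... | x∈U , x∈W | inj₁ refl | inj₂ MW = sink∉saturated (saturated MW) x∈U x∈W
  ... | x∈U , x∈W | inj₂ MU | inj₁ refl = sink∉saturated (saturated MU) x∈W x∈U
  ... | x∈U , x∈W | inj₂ MU | inj₂ MW   = U≢W (minSaturated-≡ MU MW x∈U x∈W)

  coresets-cover : ∀ v → Σ (Subset n) λ U → IsCoreset D U × v ∈ U
  coresets-cover v with hasSuccessor? v
  ... | yes succ = saturation v , saturation-coreset succ , v∈saturation
  ... | no  none = sinks D , inj₁ refl , ∈sinks⁺ λ w v↦w → none (w , v↦w)

  α-sinks⊆sources : α D (sinks D) ⊆ sources D
  α-sinks⊆sources {x} x∈ with nonempty? (sinks D)
  ... | yes nonempty = let (_ , u∈sinks , u↦x) = ∈α⁻ nonempty x∈ in ⊥-elim (∈sinks⁻ u∈sinks u↦x)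
  ... | no  empty    = subst (x ∈_) (α-empty empty) x∈

  α-coresets-disjoint : ∀ U W → IsCoreset D U → IsCoreset D W → U ≢ W → Empty (α D U ∩ α D W)
  α-coresets-disjoint U W cU cW U≢W (x , x∈αU∩αW)
    with x∈p∩q⁻ (α D U) (α D W) x∈αU∩αW | coreset⇒sinks⊎minSaturated cU | coreset⇒sinks⊎minSaturated cW
  ... | _ | inj₁ U≡sinks | inj₁ W≡sinks = U≢W (trans U≡sinks (sym W≡sinks))
  ... | x∈αU , x∈αW | inj₁ refl | inj₂ MW = ∈α⇒∉sources (nonempty MW) x∈αW (α-sinks⊆sources x∈αU)
  ... | x∈αU , x∈αW | inj₂ MU | inj₁ refl = ∈α⇒∉sources (nonempty MU) x∈αU (α-sinks⊆sources x∈αW)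
  ... | x∈αU , x∈αW | inj₂ MU | inj₂ MW   =
    let (_ , u∈U , u↦x) = ∈α⁻ (nonempty MU) x∈αU
        (_ , w∈W , w↦x) = ∈α⁻ (nonempty MW) x∈αW
    in U≢W (minSaturated-≡ MU MW u∈U (shareClosed (saturated MW) w∈W (x , w↦x , u↦x)))

  sources-α-coresets-cover : ∀ v → v ∈ sources D ⊎ Σ (Subset n) λ U → IsCoreset D U × v ∈ α D U
  sources-α-coresets-cover v with any? (λ u → D u v ≟ true)
  ... | yes (u , u↦v) = inj₂ (saturation u , saturation-coreset (v , u↦v) , ∈α⁺ v∈saturation u↦v)
  ... | no  none      = inj₁ (∈sources⁺ λ u u↦v → none (u , u↦v))

theorem2 : (n : ℕ) (D : Digraph n)
    → ((U W : Subset n) → IsCoreset D U → IsCoreset D W → U ≢ W → Empty (U ∩ W))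
    × ((v : Fin n) → Σ (Subset n) (λ U → IsCoreset D U × v ∈ U))
    × ((U W : Subset n) → IsCoreset D U → IsCoreset D W → U ≢ W → Empty (α D U ∩ α D W))
    × ((U : Subset n) → IsCoreset D U → Nonempty U → Empty (α D U ∩ sources D))
    × ((v : Fin n) → v ∈ sources D ⊎ Σ (Subset n) (λ U → IsCoreset D U × v ∈ α D U))
theorem2 n D =
    coresets-disjoint D
  , coresets-cover D
  , α-coresets-disjoint D
  , (λ _ _ → Successors.α∩sources-empty D)
  , sources-α-coresets-cover D
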